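{- Let $n$ be a positive integer and let $L_1,\ldots,L_N$ be a sequence of triples in $\{1,\ldots,n\}^3$ such that for every $i<j$ there are at least two coordinates in which $L_i$ is strictly less than $L_j$. Let $G$ be the bipartite graph on vertex set $\{a_1,\ldots,a_n,b_1,\ldots,b_n\}$ in which, for each triple $(x,y,z)$ of the sequence, $a_x$ and $b_y$ are joined by an edge labeled $z$. Then there do not exist indices $h,i,j,k,l\in\{1,\ldots,n\}$ and a label $z$ such that $i<k$, $h\le j\le l$, the edges $a_ib_h$ and $a_kb_l$ are both edges of $G$ labeled $z$, and $a_ib_j$ and $a_kb_j$ are both edges of $G$ (with arbitrary labels). -}

module Defs where

open import Data.Nat using (ℕ; _≤_; _+_)
open import Data.Fin using (Fin; _<_; _≤_)
open import Data.Product using (_×_; _,_; ∃-syntax)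
open import Data.Bool using (Bool; true; false)
open import Relation.Nullary.Decidable using (⌊_⌋)
open import Relation.Binary.PropositionalEquality using (_≡_)
import Data.Fin.Properties as FinP

-- A triple in {1,…,n}^3, represented 0-indexed as Fin n (order preserved).
Triple : ℕ → Set
Triple n = Fin n × Fin n × Fin n

ltCount : ∀ {n} → Fin n → Fin n → ℕ
ltCount x y with ⌊ x FinP.<? y ⌋
... | true  = 1
... | false = 0

numLess : ∀ {n} → Triple n → Triple n → ℕ
numLess (x₁ , y₁ , z₁) (x₂ , y₂ , z₂) = ltCount x₁ x₂ + ltCount y₁ y₂ + ltCount z₁ z₂

GoodSequence : ∀ {n N} → (Fin N → Triple n) → Set
GoodSequence {N = N} L = ∀ (i j : Fin N) → i < j → 2 Data.Nat.≤ numLess (L i) (L j)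

LabeledEdge : ∀ {n N} → (Fin N → Triple n) → Fin n → Fin n → Fin n → Set
LabeledEdge {N = N} L x y z = ∃[ m ] L m ≡ (x , y , z)

Edge : ∀ {n N} → (Fin N → Triple n) → Fin n → Fin n → Set
Edge {n} L x y = ∃[ z ] LabeledEdge L x y z

-- Two triples of the sequence sharing a coordinate differ in the other two,
-- both in the direction of their indices.  Along the fixed vertex a_i the
-- labels therefore grow with the b-endpoint, and along the fixed vertex b_j
-- they grow strictly with the a-endpoint.  The configuration would give
-- z ≤ z₁ < z₂ ≤ z for the labels z₁, z₂ of a_i b_j and a_k b_j.
module Submission where

open import Defs
open import Data.Nat using (ℕ; NonZero; s≤s)
import Data.Nat as ℕ using (_≤_; _+_)
open import Data.Nat.Properties using (+-identityʳ; <⇒≤; <⇒≱; ≤-<-trans; <-≤-trans)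
open import Data.Fin using (Fin; _<_; _≤_)
open import Data.Fin.Properties using (_<?_; <-cmp; <-irrefl; <-asym; ≤-reflexive)
open import Data.Product using (_×_; ∃-syntax; _,_; proj₁; proj₂)
open import Function using (_∘_)
open import Relation.Nullary using (¬_; yes; no; contradiction)
open import Relation.Binary using (tri<; tri≈; tri>)
open import Relation.Binary.PropositionalEquality using (_≡_; refl; sym; trans; cong; subst₂)

ltCount-self : ∀ {n} (x : Fin n) → ltCount x x ≡ 0
ltCount-self x with x <? x
... | yes x<x = contradiction x<x (<-irrefl refl)
... | no _    = refl

both-<-of-ltCount : ∀ {n} {a b c d : Fin n} →
                    2 ℕ.≤ ltCount a b ℕ.+ ltCount c d → a < b × c < d
both-<-of-ltCount {a = a} {b} {c} {d} p with a <? b | c <? d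
... | yes a<b | yes c<d = a<b , c<d
... | yes _   | no _    = contradiction p λ { (s≤s ()) }
... | no _    | yes _   = contradiction p λ { (s≤s ()) }
... | no _    | no _    = contradiction p λ ()

sameFirst⇒< : ∀ {n} {x y y′ z z′ : Fin n} →
              2 ℕ.≤ numLess (x , y , z) (x , y′ , z′) → y < y′ × z < z′
sameFirst⇒< {x = x} p rewrite ltCount-self x = both-<-of-ltCount p

sameSecond⇒< : ∀ {n} {x x′ y z z′ : Fin n} →
               2 ℕ.≤ numLess (x , y , z) (x′ , y , z′) → x < x′ × z < z′
sameSecond⇒< {x = x} {x′} {y} p
  rewrite ltCount-self y | +-identityʳ (ltCount x x′) = both-<-of-ltCount p

module _ {n N : ℕ} {L : Fin N → Triple n} (good : GoodSequence L) where

  good-at : ∀ {m m′ s t} → L m ≡ s → L m′ ≡ t → m < m′ → 2 ℕ.≤ numLess s t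
  good-at {m} {m′} e e′ m<m′ = subst₂ (λ s t → 2 ℕ.≤ numLess s t) e e′ (good m m′ m<m′)

  label-≤-at-fixed-a : ∀ {x y y′ z z′} → LabeledEdge L x y z → LabeledEdge L x y′ z′ →
                       y ≤ y′ → z ≤ z′
  label-≤-at-fixed-a {x} (m , e) (m′ , e′) y≤y′ with <-cmp m m′
  ... | tri< m<m′ _ _ = <⇒≤ (proj₂ (sameFirst⇒< {x = x} (good-at e e′ m<m′)))
  ... | tri≈ _ refl _ = ≤-reflexive (cong (proj₂ ∘ proj₂) (trans (sym e) e′))
  ... | tri> _ _ m′<m = contradiction y≤y′ (<⇒≱ (proj₁ (sameFirst⇒< {x = x} (good-at e′ e m′<m))))

  label-<-at-fixed-b : ∀ {x x′ y z z′} → LabeledEdge L x y z → LabeledEdge L x′ y z′ →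
                       x < x′ → z < z′
  label-<-at-fixed-b {y = y} (m , e) (m′ , e′) x<x′ with <-cmp m m′
  ... | tri< m<m′ _ _ = proj₂ (sameSecond⇒< {y = y} (good-at e e′ m<m′))
  ... | tri≈ _ refl _ = contradiction x<x′ (<-irrefl (cong proj₁ (trans (sym e) e′)))
  ... | tri> _ _ m′<m = contradiction x<x′ (<-asym (proj₁ (sameSecond⇒< {y = y} (good-at e′ e m′<m))))

lemma3 : (n : ℕ) → .{{_ : NonZero n}} → (N : ℕ) → (L : Fin N → Triple n) → GoodSequence L →
         ¬ (∃[ h ] ∃[ i ] ∃[ j ] ∃[ k ] ∃[ l ] ∃[ z ]
              (i < k × h ≤ j × j ≤ l ×
               LabeledEdge L i h z × LabeledEdge L k l z ×
               Edge L i j × Edge L k j))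
lemma3 n N L good (h , i , j , k , l , z , i<k , h≤j , j≤l , ihz , klz , (z₁ , ijz₁) , (z₂ , kjz₂)) =
  <-irrefl refl (≤-<-trans z≤z₁ (<-≤-trans z₁<z₂ z₂≤z))
  where
  z≤z₁ : z ≤ z₁
  z≤z₁ = label-≤-at-fixed-a good ihz ijz₁ h≤j
  z₁<z₂ : z₁ < z₂
  z₁<z₂ = label-<-at-fixed-b good ijz₁ kjz₂ i<k
  z₂≤z : z₂ ≤ z
  z₂≤z = label-≤-at-fixed-a good kjz₂ klz j≤l
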